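{- Let $\mathbb F$ be a field and $n\ge k$ with $n+k$ even. Then for all $1\le i\le n$ and $1\le j\le k$ the map $\mathbf S_{i\,j}$ is an invertible linear map on $\mathcal M_{n\,k}(\mathbb F)$ satisfying $\det_{n\,k}(\mathbf S_{i\,j}(X))=\det_{n\,k}(X)$ for all $X\in\mathcal M_{n\,k}(\mathbb F)$.
   Context: $\mathcal M_{n\,k}(\mathbb F)$ denotes the $n\times k$ matrices over $\mathbb F$. The Cullis determinant of $X\in\mathcal M_{n\,k}(\mathbb F)$ ($n\ge k$) is $\det_{n\,k}(X)=\sum_{1\le c_1<\cdots<c_k\le n}(-1)^{\sum_{\alpha=1}^k(c_\alpha-\alpha)}\det(X[c_1,\ldots,c_k|))$, where $X[c_1,\ldots,c_k|)$ is the $k\times k$ submatrix formed by rows $c_1,\ldots,c_k$. For $1\le i\le n$, $1\le j\le k$, the linear map $\mathbf S_{i\,j}\colon\mathcal M_{n\,k}(\mathbb F)\to\mathcal M_{n\,k}(\mathbb F)$ sends $X$ to the matrix obtained by: (1) cyclically shifting the rows so that the rows appear in the order $i,i+1,\ldots,n,1,\ldots,i-1$; (2) multiplying the bottom $i-1$ rows (those coming from original rows $1,\ldots,i-1$) by $-1$; (3) exchanging the first and the $j$-th column; (4) multiplying the first column by $(-1)^{1-\delta_{1\,j}}$ (i.e. by $-1$ if $j\ne1$); (5) multiplying all entries by $(-1)^{n-i}$. -}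

module Defs where

open import Level using (Level; _⊔_)
open import Algebra.Bundles using (CommutativeRing)
open import Data.Nat as ℕ using (ℕ; zero; suc)
import Data.Nat.Properties
open Data.Nat.Properties using ( ≮⇒≥; ∸-monoˡ-<; +-mono-<; m+n∸n≡m)
open import Data.Fin as Fin using (Fin; toℕ; fromℕ<)
open import Data.Fin.Properties using (toℕ<n)
open import Data.Vec as Vec using (Vec; []; _∷_; lookup)
open import Data.List as List using (List; []; _∷_; _++_)
open import Data.Product using (Σ; _×_; _,_; proj₁; proj₂)
open import Relation.Nullary using (¬_; yes; no)
open import Relation.Binary.PropositionalEquality using (_≡_; refl; subst; sym)

record Field (c ℓ : Level) : Set (Level.suc (c ⊔ ℓ)) where
  field
    commutativeRing : CommutativeRing c ℓ
  open CommutativeRing commutativeRing public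
  field
    1≉0     : ¬ (1# ≈ 0#)
    inverse : ∀ x → ¬ (x ≈ 0#) → Σ Carrier λ y → (x * y) ≈ 1#

zeroOf : ∀ {k} → Fin k → Fin k
zeroOf Fin.zero    = Fin.zero
zeroOf (Fin.suc _) = Fin.zero

wrapLemma : ∀ n a b → a ℕ.< n → b ℕ.< n → ¬ (a ℕ.+ b ℕ.< n) → (a ℕ.+ b) ℕ.∸ n ℕ.< n
wrapLemma n a b a<n b<n h =
  subst (λ t → (a ℕ.+ b) ℕ.∸ n ℕ.< t) (m+n∸n≡m n n) (∸-monoˡ-< (+-mono-< a<n b<n) (≮⇒≥ h))

module _ {c ℓ : Level} (F : Field c ℓ) where
  open Field F

  Mat : ℕ → ℕ → Set c
  Mat n k = Fin n → Fin k → Carrier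

  _≈M_ : ∀ {n k} → Mat n k → Mat n k → Set ℓ
  X ≈M Y = ∀ r s → X r s ≈ Y r s

  sgn : ℕ → Carrier
  sgn zero    = 1#
  sgn (suc m) = - (sgn m)

  sumL : List Carrier → Carrier
  sumL []       = 0#
  sumL (x ∷ xs) = x + sumL xs

  sumFin : ∀ {m} → (Fin m → Carrier) → Carrier
  sumFin {zero}  f = 0#
  sumFin {suc m} f = f Fin.zero + sumFin (λ a → f (Fin.suc a))

  delRow : ∀ {m k} → Fin (suc m) → Mat (suc m) k → Mat m k
  delRow r X a s = X (Fin.punchIn r a) s

  det : ∀ {m} → Mat m m → Carrier
  det {zero}  X = 1#
  det {suc m} X =
    sumFin (λ r → sgn (toℕ r) * (X r Fin.zero *
                   det (λ a b → delRow r X a (Fin.suc b))))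

  -- all strictly increasing sequences c₀ < c₁ < … < c_{k-1} in Fin n
  increasing : (n k : ℕ) → List (Vec (Fin n) k)
  increasing n       zero    = [] ∷ []
  increasing zero    (suc k) = []
  increasing (suc n) (suc k) =
       List.map (λ v → Fin.zero ∷ Vec.map Fin.suc v) (increasing n k)
    ++ List.map (Vec.map Fin.suc) (increasing n (suc k))

  sumVecℕ : ∀ {k} → Vec ℕ k → ℕ
  sumVecℕ []       = 0
  sumVecℕ (x ∷ xs) = x ℕ.+ sumVecℕ xs

  -- Σ_α (c_α - α)  (0-based indices; same value as the 1-based formula)
  signExp : ∀ {n k} → Vec (Fin n) k → ℕ
  signExp {k = k} v =
    sumVecℕ (Vec.map toℕ v) ℕ.∸ sumVecℕ (Vec.map toℕ (Vec.allFin k))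

  rowsSub : ∀ {n k} → Vec (Fin n) k → Mat n k → Mat k k
  rowsSub v X a s = X (lookup v a) s

  cullis : ∀ {n k} → Mat n k → Carrier
  cullis {n} {k} X =
    sumL (List.map (λ v → sgn (signExp v) * det (rowsSub v X)) (increasing n k))

  -- Step (1)-(2) of S_{i j}: new row r (0-based) is the old row i + r
  -- (mod n); if it wrapped around (old row above row i) it gets the sign -1.
  cycRow : ∀ {n} → Fin n → Fin n → Fin n × Carrier
  cycRow {n} i r with toℕ i ℕ.+ toℕ r Data.Nat.Properties.<? n
  ... | yes p = fromℕ< p , 1#
  ... | no  p = fromℕ< (wrapLemma n (toℕ i) (toℕ r) (toℕ<n i) (toℕ<n r) p) , - 1#

  -- Step (3): the transposition of column 0 and column j
  swapCol : ∀ {k} → Fin k → Fin k → Fin k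
  swapCol j s with s Fin.≟ zeroOf j
  ... | yes _ = j
  ... | no  _ with s Fin.≟ j
  ...   | yes _ = zeroOf j
  ...   | no  _ = s

  -- Step (4): factor on column s (after the swap): -1 on the first column
  -- when j ≠ first column, 1 otherwise
  colSign : ∀ {k} → Fin k → Fin k → Carrier
  colSign j s with s Fin.≟ zeroOf j | j Fin.≟ zeroOf j
  ... | yes _ | no _ = - 1#
  ... | _     | _    = 1#

  -- the map S_{i j} (i, j given 0-based: i = i₁ - 1, j = j₁ - 1);
  -- step (5) multiplies by (-1)^(n - i₁) = (-1)^(n - (toℕ i + 1))
  S : ∀ {n k} → Fin n → Fin k → Mat n k → Mat n k
  S {n} i j X r s =
    sgn (n ℕ.∸ suc (toℕ i)) *
      (colSign j s * (proj₂ (cycRow i r) * X (proj₁ (cycRow i r)) (swapCol j s)))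

  IsLinear : ∀ {n k} → (Mat n k → Mat n k) → Set (c ⊔ ℓ)
  IsLinear {n} {k} T =
      (∀ (X Y : Mat n k) → T (λ r s → X r s + Y r s) ≈M (λ r s → T X r s + T Y r s))
    × (∀ (a : Carrier) (X : Mat n k) → T (λ r s → a * X r s) ≈M (λ r s → a * T X r s))

  IsInvertible : ∀ {n k} → (Mat n k → Mat n k) → Set (c ⊔ ℓ)
  IsInvertible {n} {k} T =
    Σ (Mat n k → Mat n k) λ U →
      IsLinear U × (∀ X → U (T X) ≈M X) × (∀ X → T (U X) ≈M X)

-- The Cullis determinant obeys the Laplace expansion along its first column: both sides sum
-- over an increasing selection of k rows together with a pivot among them, with the same sign.
-- Hence it equals the recursively defined `laplace`, and everything follows from that recursion.
-- Exchanging two columns negates it, so steps (3)–(4) of S preserve it. Moving the first row to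
-- the bottom and negating it multiplies it by (−1)^k provided (−1)^n = (−1)^k, and steps (1)–(2)
-- are i − 1 such moves; step (5) multiplies it by (−1)^(k(n−i)). The total sign is (−1)^(k(n−1)) = 1
-- because n + k is even. Finally, S only permutes and re-signs entries, so it is linear and has
-- an inverse of the same form.
module Submission where

open import Level using (Level; _⊔_)
open import Algebra.Bundles using (Semiring)
import Algebra.Definitions.RawSemiring as RawSemiringDefinitions
import Algebra.Properties.CommutativeSemigroup as CommutativeSemigroupProperties
import Algebra.Properties.Ring as RingProperties
import Algebra.Properties.Semiring.Sum as SemiringSum
import Algebra.Solver.CommutativeMonoid as CommutativeMonoidSolver
open import Data.Fin as Fin using (Fin; zero; suc; toℕ; punchIn; inject₁; fromℕ)
import Data.Fin.Properties as Fin
open import Data.List as List using (List; []; _∷_; _++_)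
open import Data.List.Relation.Unary.All as All using (All; []; _∷_)
import Data.List.Relation.Unary.All.Properties as All
open import Data.Maybe as Maybe using (Maybe; just; nothing; maybe′)
open import Data.Maybe.Properties using (maybe′-map; map-∘)
open import Data.Nat as ℕ using (ℕ; zero; suc)
import Data.Nat.Properties as ℕ
open import Data.Nat.Divisibility using (_∣_; divides; ∣m∣n⇒∣m+n; ∣m+n∣m⇒∣n; ∣n⇒∣m*n; m∣m*n)
open import Data.Nat.GeneralisedArithmetic using (fold)
open import Data.Nat.Tactic.RingSolver using (solve-∀)
open import Data.Product as Product using (_×_; _,_; proj₁; proj₂)
open import Data.Vec as Vec using (Vec; lookup)
open import Data.Vec.Properties using (lookup-map; tabulate-∘)
open import Data.Vec.Functional as Vector using (Vector)
open import Relation.Binary.PropositionalEquality as ≡ using (_≡_; _≢_)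
open import Relation.Nullary using (¬_; Dec; yes; no; contradiction)

open import Defs

2∣n*[1+n] : ∀ n → 2 ∣ n ℕ.* suc n
2∣n*[1+n] zero    = divides 0 ≡.refl
2∣n*[1+n] (suc n) = ≡.subst (2 ∣_) (≡.sym (expand n))
  (∣m∣n⇒∣m+n (2∣n*[1+n] n) (m∣m*n (suc n)))
  where
  expand : ∀ n → suc n ℕ.* suc (suc n) ≡ n ℕ.* suc n ℕ.+ 2 ℕ.* suc n
  expand = solve-∀

2∣1+m+k⇒2∣k*m : ∀ m k → 2 ∣ suc m ℕ.+ k → 2 ∣ k ℕ.* m
2∣1+m+k⇒2∣k*m m k 2∣1+m+k =
  ∣m+n∣m⇒∣n (≡.subst (2 ∣_) (expand m k) (∣n⇒∣m*n k 2∣1+m+k)) (2∣n*[1+n] k)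
  where
  expand : ∀ m k → k ℕ.* (suc m ℕ.+ k) ≡ k ℕ.* suc k ℕ.+ k ℕ.* m
  expand = solve-∀

module _ {c ℓ : Level} (F : Field c ℓ) where
  open Field F hiding (zero)
  open RingProperties ring using (-‿distribˡ-*; -‿distribʳ-*; -‿involutive; -‿+-comm; -1*x≈-x; -‿injective; -0#≈0#)
  open SemiringSum semiring using (sum; sum-syntax; sum-cong-≋; ∑-distrib-+; *-distribˡ-sum; sum-init-last)
  open RawSemiringDefinitions (Semiring.rawSemiring semiring) using (_^_)
  open CommutativeSemigroupProperties +-commutativeSemigroup using ()
    renaming (interchange to +-interchange; x∙yz≈y∙xz to x+[y+z]≈y+[x+z])
  open CommutativeSemigroupProperties *-commutativeSemigroup using (x∙yz≈y∙xz)
  open CommutativeMonoidSolver *-commutativeMonoid using (solve; _⊜_; _⊕_)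
  open import Relation.Binary.Reasoning.Setoid setoid

  -x*-y≈x*y : ∀ x y → - x * - y ≈ x * y
  -x*-y≈x*y x y = begin
    - x * - y     ≈⟨ -‿distribˡ-* x (- y) ⟨
    - (x * - y)   ≈⟨ -‿cong (-‿distribʳ-* x y) ⟨
    - - (x * y)   ≈⟨ -‿involutive (x * y) ⟩
    x * y         ∎

  -1*-1≈1 : - 1# * - 1# ≈ 1#
  -1*-1≈1 = trans (-x*-y≈x*y 1# 1#) (*-identityˡ 1#)

  sgn-+ : ∀ a b → sgn F (a ℕ.+ b) ≈ sgn F a * sgn F b
  sgn-+ zero    b = sym (*-identityˡ _)
  sgn-+ (suc a) b = trans (-‿cong (sgn-+ a b)) (-‿distribˡ-* _ _)

  sgn*sgn≈1 : ∀ a → sgn F a * sgn F a ≈ 1#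
  sgn*sgn≈1 zero    = *-identityˡ 1#
  sgn*sgn≈1 (suc a) = trans (-x*-y≈x*y _ _) (sgn*sgn≈1 a)

  sgn-even : ∀ {a} → 2 ∣ a → sgn F a ≈ 1#
  sgn-even (divides q ≡.refl) = go q
    where
    go : ∀ q → sgn F (q ℕ.* 2) ≈ 1#
    go zero    = refl
    go (suc q) = trans (-‿involutive _) (go q)

  sgn-parity : ∀ a b → 2 ∣ a ℕ.+ b → sgn F a ≈ sgn F b
  sgn-parity a b 2∣a+b = begin
    sgn F a                       ≈⟨ *-identityʳ _ ⟨
    sgn F a * 1#                  ≈⟨ *-congˡ (sgn*sgn≈1 b) ⟨
    sgn F a * (sgn F b * sgn F b) ≈⟨ *-assoc _ _ _ ⟨
    sgn F a * sgn F b * sgn F b   ≈⟨ *-congʳ (trans (sym (sgn-+ a b)) (sgn-even 2∣a+b)) ⟩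
    1# * sgn F b                  ≈⟨ *-identityˡ _ ⟩
    sgn F b                       ∎

  sgn-^ : ∀ e k → sgn F e ^ k ≈ sgn F (k ℕ.* e)
  sgn-^ e zero    = refl
  sgn-^ e (suc k) = trans (*-congˡ (sgn-^ e k)) (sym (sgn-+ e (k ℕ.* e)))

  -- Finite sums

  -‿distrib-sum : ∀ {n} (f : Vector Carrier n) → - sum f ≈ sum (λ i → - f i)
  -‿distrib-sum {zero}  f = -0#≈0#
  -‿distrib-sum {suc n} f = trans (sym (-‿+-comm _ _)) (+-congˡ (-‿distrib-sum (λ i → f (suc i))))

  ∑-negate : ∀ {n} (x y : Vector Carrier n) → (∀ r → x r ≈ - y r) → sum x ≈ - sum y
  ∑-negate x y x≈-y = trans (sum-cong-≋ x≈-y) (sym (-‿distrib-sum y))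

  ∑-negate-terms : ∀ {n} (t : Vector Carrier n) (x y : Vector Carrier n) → (∀ r → x r ≈ - y r) →
                   ∑[ r < n ] (t r * x r) ≈ - ∑[ r < n ] (t r * y r)
  ∑-negate-terms t x y x≈-y = ∑-negate _ (λ r → t r * y r) λ r →
    trans (*-congˡ (x≈-y r)) (sym (-‿distribʳ-* (t r) (y r)))

  ∑-sgn-shift : ∀ {n} s (A : Vector Carrier n) →
                - s * ∑[ ρ < n ] (sgn F (toℕ ρ) * A ρ) ≈ ∑[ ρ < n ] (sgn F (suc (toℕ ρ)) * (s * A ρ))
  ∑-sgn-shift s A = trans (*-distribˡ-sum (- s) (λ ρ → sgn F (toℕ ρ) * A ρ)) (sum-cong-≋ λ ρ → begin
    - s * (sgn F (toℕ ρ) * A ρ)   ≈⟨ x∙yz≈y∙xz (- s) _ _ ⟩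
    sgn F (toℕ ρ) * (- s * A ρ)   ≈⟨ *-congˡ (-‿distribˡ-* s (A ρ)) ⟨
    sgn F (toℕ ρ) * - (s * A ρ)   ≈⟨ -‿distribʳ-* _ _ ⟨
    - (sgn F (toℕ ρ) * (s * A ρ)) ≈⟨ -‿distribˡ-* _ _ ⟩
    - sgn F (toℕ ρ) * (s * A ρ)   ∎)

  ∑-sgn-shift-+ : ∀ {n} s (W V : Vector Carrier n) →
                  - ∑[ ρ < n ] (sgn F (toℕ ρ) * W ρ) + - s * ∑[ ρ < n ] (sgn F (toℕ ρ) * V ρ)
                    ≈ ∑[ ρ < n ] (sgn F (suc (toℕ ρ)) * (W ρ + s * V ρ))
  ∑-sgn-shift-+ s W V = begin
    - ∑[ ρ < _ ] (sgn F (toℕ ρ) * W ρ) + - s * ∑[ ρ < _ ] (sgn F (toℕ ρ) * V ρ)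
      ≈⟨ +-cong (trans (-‿distrib-sum (λ ρ → sgn F (toℕ ρ) * W ρ))
                       (sum-cong-≋ λ ρ → -‿distribˡ-* (sgn F (toℕ ρ)) (W ρ)))
                (∑-sgn-shift s V) ⟩
    ∑[ ρ < _ ] (sgn F (suc (toℕ ρ)) * W ρ) + ∑[ ρ < _ ] (sgn F (suc (toℕ ρ)) * (s * V ρ))
      ≈⟨ ∑-distrib-+ (λ ρ → sgn F (suc (toℕ ρ)) * W ρ) (λ ρ → sgn F (suc (toℕ ρ)) * (s * V ρ)) ⟨
    ∑[ ρ < _ ] (sgn F (suc (toℕ ρ)) * W ρ + sgn F (suc (toℕ ρ)) * (s * V ρ))
      ≈⟨ sum-cong-≋ (λ ρ → distribˡ (sgn F (suc (toℕ ρ))) (W ρ) (s * V ρ)) ⟨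
    ∑[ ρ < _ ] (sgn F (suc (toℕ ρ)) * (W ρ + s * V ρ)) ∎

  sumFin≡sum : ∀ {n} (f : Vector Carrier n) → sumFin F f ≡ sum f
  sumFin≡sum {zero}  f = ≡.refl
  sumFin≡sum {suc n} f = ≡.cong (f zero +_) (sumFin≡sum (λ i → f (suc i)))

  sumOver : {A : Set} → List A → (A → Carrier) → Carrier
  sumOver xs f = sumL F (List.map f xs)

  sumOver-cong : {A : Set} (xs : List A) {f g : A → Carrier} → (∀ x → f x ≈ g x) → sumOver xs f ≈ sumOver xs g
  sumOver-cong []       f≈g = refl
  sumOver-cong (x ∷ xs) f≈g = +-cong (f≈g x) (sumOver-cong xs f≈g)

  sumOver-congᴬ : {A : Set} {P : A → Set} {xs : List A} {f g : A → Carrier} →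
                  All P xs → (∀ x → P x → f x ≈ g x) → sumOver xs f ≈ sumOver xs g
  sumOver-congᴬ []         f≈g = refl
  sumOver-congᴬ (px ∷ pxs) f≈g = +-cong (f≈g _ px) (sumOver-congᴬ pxs f≈g)

  sumOver-++ : {A : Set} (xs ys : List A) (f : A → Carrier) → sumOver (xs ++ ys) f ≈ sumOver xs f + sumOver ys f
  sumOver-++ []       ys f = sym (+-identityˡ _)
  sumOver-++ (x ∷ xs) ys f = trans (+-congˡ (sumOver-++ xs ys f)) (sym (+-assoc _ _ _))

  sumOver-map : {A B : Set} (xs : List A) (g : A → B) (f : B → Carrier) →
                sumOver (List.map g xs) f ≈ sumOver xs (λ x → f (g x))
  sumOver-map []       g f = refl
  sumOver-map (x ∷ xs) g f = +-congˡ (sumOver-map xs g f)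

  *-distribˡ-sumOver : {A : Set} (xs : List A) (a : Carrier) (f : A → Carrier) →
                       a * sumOver xs f ≈ sumOver xs (λ x → a * f x)
  *-distribˡ-sumOver []       a f = zeroʳ a
  *-distribˡ-sumOver (x ∷ xs) a f = trans (distribˡ a _ _) (+-congˡ (*-distribˡ-sumOver xs a f))

  sumOver-distrib-+ : {A : Set} (xs : List A) (f g : A → Carrier) →
                      sumOver xs (λ x → f x + g x) ≈ sumOver xs f + sumOver xs g
  sumOver-distrib-+ []       f g = sym (+-identityˡ 0#)
  sumOver-distrib-+ (x ∷ xs) f g = trans (+-congˡ (sumOver-distrib-+ xs f g)) (+-interchange _ _ _ _)

  -‿distrib-sumOver : {A : Set} (xs : List A) (f : A → Carrier) → - sumOver xs f ≈ sumOver xs (λ x → - f x)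
  -‿distrib-sumOver []       f = -0#≈0#
  -‿distrib-sumOver (x ∷ xs) f = trans (sym (-‿+-comm _ _)) (+-congˡ (-‿distrib-sumOver xs f))

  -- Laplace expansion along the first column

  minor : ∀ {n k} → Fin (suc n) → Mat F (suc n) (suc k) → Mat F n k
  minor r X a b = X (punchIn r a) (suc b)

  -- Defined for every shape; it vanishes when there are more columns than rows.
  laplace : ∀ {n k} → Mat F n k → Carrier
  laplace {n}     {zero}  X = 1#
  laplace {zero}  {suc k} X = 0#
  laplace {suc n} {suc k} X = ∑[ r < suc n ] (sgn F (toℕ r) * (X r zero * laplace (minor r X)))

  laplace-cong : ∀ {n k} {X Y : Mat F n k} → _≈M_ F X Y → laplace X ≈ laplace Y
  laplace-cong {n}     {zero}  X≈Y = refl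
  laplace-cong {zero}  {suc k} X≈Y = refl
  laplace-cong {suc n} {suc k} X≈Y = sum-cong-≋ λ r →
    *-congˡ {sgn F (toℕ r)} (*-cong (X≈Y r zero) (laplace-cong (λ a b → X≈Y (punchIn r a) (suc b))))

  det≈laplace : ∀ {m} (X : Mat F m m) → det F X ≈ laplace X
  det≈laplace {zero}  X = refl
  det≈laplace {suc m} X =
    trans (reflexive (sumFin≡sum (λ r → sgn F (toℕ r) * (X r zero * det F (minor r X)))))
          (sum-cong-≋ λ r → *-congˡ {sgn F (toℕ r)} (*-congˡ {X r zero} (det≈laplace (minor r X))))

  det-cong : ∀ {m} {X Y : Mat F m m} → _≈M_ F X Y → det F X ≈ det F Y
  det-cong {X = X} {Y} X≈Y = trans (det≈laplace X) (trans (laplace-cong X≈Y) (sym (det≈laplace Y)))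

  laplace-negate-column₀ : ∀ {n k} {X Y : Mat F n (suc k)} →
    (∀ r → Y r zero ≈ - X r zero) → (∀ r s → Y r (suc s) ≈ X r (suc s)) → laplace Y ≈ - laplace X
  laplace-negate-column₀ {zero}          Y≈-X Y≈X = sym -0#≈0#
  laplace-negate-column₀ {suc n} {X = X} {Y} Y≈-X Y≈X = ∑-negate-terms (λ r → sgn F (toℕ r)) _
    (λ r → X r zero * laplace (minor r X))
    (λ r → trans (*-cong (Y≈-X r) (laplace-cong λ a b → Y≈X (punchIn r a) b)) (sym (-‿distribˡ-* _ _)))

  laplace-scale : ∀ {n k} (a : Carrier) (Y : Mat F n k) → laplace (λ r s → a * Y r s) ≈ a ^ k * laplace Y
  laplace-scale {n}     {zero}  a Y = sym (*-identityˡ 1#)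
  laplace-scale {zero}  {suc k} a Y = sym (zeroʳ _)
  laplace-scale {suc m} {suc k} a Y = begin
    ∑[ r < suc m ] (sgn F (toℕ r) * (a * Y r zero * laplace (λ r′ s → a * minor r Y r′ s)))
      ≈⟨ sum-cong-≋ (λ r → trans (*-congˡ (*-congˡ (laplace-scale a (minor r Y))))
                                 (regroup (sgn F (toℕ r)) a (Y r zero) (a ^ k) (laplace (minor r Y)))) ⟩
    ∑[ r < suc m ] (a * a ^ k * (sgn F (toℕ r) * (Y r zero * laplace (minor r Y))))
      ≈⟨ *-distribˡ-sum (a * a ^ k) (λ r → sgn F (toℕ r) * (Y r zero * laplace (minor r Y))) ⟨
    a * a ^ k * laplace Y ∎
    where
    regroup : ∀ s a y p c → s * ((a * y) * (p * c)) ≈ (a * p) * (s * (y * c))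
    regroup = solve 5 (λ s a y p c → s ⊕ ((a ⊕ y) ⊕ (p ⊕ c)) ⊜ (a ⊕ p) ⊕ (s ⊕ (y ⊕ c))) refl

  -- The Cullis determinant obeys the Laplace expansion

  rowSum : ∀ {n k} → Vec (Fin n) k → ℕ
  rowSum v = sumVecℕ F (Vec.map toℕ v)

  rowSum-map-suc : ∀ {n k} (v : Vec (Fin n) k) → rowSum (Vec.map suc v) ≡ k ℕ.+ rowSum v
  rowSum-map-suc Vec.[]                  = ≡.refl
  rowSum-map-suc {k = suc k} (x Vec.∷ v) =
    ≡.cong suc (≡.trans (≡.cong (toℕ x ℕ.+_) (rowSum-map-suc v)) (shuffle (toℕ x) k (rowSum v)))
    where
    shuffle : ∀ a b c → a ℕ.+ (b ℕ.+ c) ≡ b ℕ.+ (a ℕ.+ c)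
    shuffle = solve-∀

  indexSum : ℕ → ℕ
  indexSum k = rowSum (Vec.allFin k)

  indexSum-suc : ∀ k → indexSum (suc k) ≡ k ℕ.+ indexSum k
  indexSum-suc k = ≡.trans (≡.cong rowSum (tabulate-∘ {n = k} suc (λ i → i))) (rowSum-map-suc (Vec.allFin k))

  signExp-zero∷ : ∀ {n k} (v : Vec (Fin n) k) → signExp F (zero Vec.∷ Vec.map suc v) ≡ signExp F v
  signExp-zero∷ {k = k} v = ≡.trans (≡.cong₂ ℕ._∸_ (rowSum-map-suc v) (indexSum-suc k))
                                    (ℕ.[m+n]∸[m+o]≡n∸o k (rowSum v) (indexSum k))

  -- signExp subtracts with truncation; on increasing sequences nothing is truncated.
  indexSum≤rowSum : ∀ n k → All (λ v → indexSum k ℕ.≤ rowSum v) (increasing F n k)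
  indexSum≤rowSum n       zero    = ℕ.z≤n ∷ []
  indexSum≤rowSum zero    (suc k) = []
  indexSum≤rowSum (suc n) (suc k) = All.++⁺
    (All.map⁺ (All.map (λ {v} → containing₀ v) (indexSum≤rowSum n k)))
    (All.map⁺ (All.map (λ {u} → avoiding₀ u) (indexSum≤rowSum n (suc k))))
    where
    containing₀ : (v : Vec (Fin n) k) → indexSum k ℕ.≤ rowSum v →
                  indexSum (suc k) ℕ.≤ rowSum (zero Vec.∷ Vec.map suc v)
    containing₀ v le = ≡.subst₂ ℕ._≤_ (≡.sym (indexSum-suc k)) (≡.sym (rowSum-map-suc v)) (ℕ.+-monoʳ-≤ k le)
    avoiding₀ : (u : Vec (Fin n) (suc k)) → indexSum (suc k) ℕ.≤ rowSum u →
                indexSum (suc k) ℕ.≤ rowSum (Vec.map suc u)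
    avoiding₀ u le = ≡.subst (indexSum (suc k) ℕ.≤_) (≡.sym (rowSum-map-suc u))
                             (ℕ.≤-trans le (ℕ.m≤n+m (rowSum u) (suc k)))

  signExp-map-suc : ∀ {n k} (u : Vec (Fin n) k) → indexSum k ℕ.≤ rowSum u →
                    signExp F (Vec.map suc u) ≡ k ℕ.+ signExp F u
  signExp-map-suc {k = k} u le = ≡.trans (≡.cong (ℕ._∸ indexSum k) (rowSum-map-suc u)) (ℕ.+-∸-assoc k le)

  sumOver-increasing-split : ∀ {n k} (f : Vec (Fin (suc n)) (suc k) → Carrier) →
    sumOver (increasing F (suc n) (suc k)) f ≈
      sumOver (increasing F n k) (λ v → f (zero Vec.∷ Vec.map suc v))
        + sumOver (increasing F n (suc k)) (λ u → f (Vec.map suc u))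
  sumOver-increasing-split {n} {k} f = trans (sumOver-++ (List.map (λ v → zero Vec.∷ Vec.map suc v) (increasing F n k)) _ f)
    (+-cong (sumOver-map (increasing F n k) _ f) (sumOver-map (increasing F n (suc k)) (Vec.map suc) f))

  sumOver-signed-map-suc : ∀ n k (f : Vec (Fin (suc n)) k → Carrier) (h : Vec (Fin n) k → Carrier) →
    (∀ u → f (Vec.map suc u) ≈ h u) →
    sumOver (increasing F n k) (λ u → sgn F (signExp F (Vec.map suc u)) * f (Vec.map suc u))
      ≈ sgn F k * sumOver (increasing F n k) (λ u → sgn F (signExp F u) * h u)
  sumOver-signed-map-suc n k f h f≈h = begin
    sumOver (increasing F n k) (λ u → sgn F (signExp F (Vec.map suc u)) * f (Vec.map suc u))
      ≈⟨ sumOver-congᴬ (indexSum≤rowSum n k) (λ u le →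
           trans (*-cong (trans (reflexive (≡.cong (sgn F) (signExp-map-suc u le))) (sgn-+ k _)) (f≈h u))
                 (*-assoc _ _ _)) ⟩
    sumOver (increasing F n k) (λ u → sgn F k * (sgn F (signExp F u) * h u))
      ≈⟨ *-distribˡ-sumOver (increasing F n k) (sgn F k) _ ⟨
    sgn F k * sumOver (increasing F n k) (λ u → sgn F (signExp F u) * h u) ∎

  -- g r f weighs the pivot row r together with the other selected rows f, listed in increasing
  -- order; for the Cullis determinant g r f = X r 0 · det (rows f, columns after the first).
  Weight : ℕ → ℕ → Set c
  Weight N k = Fin N → (Fin k → Fin N) → Carrier

  Extensional : ∀ {N k} → Weight N k → Set ℓ
  Extensional g = ∀ r {f f′} → (∀ a → f a ≡ f′ a) → g r f ≈ g r f′

  weight-cong : ∀ {N k} {g : Weight N k} → Extensional g →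
                ∀ {r r′ f f′} → r ≡ r′ → (∀ a → f a ≡ f′ a) → g r f ≈ g r′ f′
  weight-cong g-ext ≡.refl f≗f′ = g-ext _ f≗f′

  -- Weights on the rows after row 0, for selections avoiding row 0 and containing it respectively.
  avoid₀ : ∀ {N k} → Weight (suc N) k → Weight N k
  avoid₀ g r f = g (suc r) (λ a → suc (f a))

  with₀ : ∀ {N k} → Weight (suc N) (suc k) → Weight N k
  with₀ g r f = g (suc r) (zero Vector.∷ λ a → suc (f a))

  avoid₀-ext : ∀ {N k} {g : Weight (suc N) k} → Extensional g → Extensional (avoid₀ g)
  avoid₀-ext g-ext r f≗f′ = g-ext (suc r) (λ a → ≡.cong suc (f≗f′ a))

  with₀-ext : ∀ {N k} {g : Weight (suc N) (suc k)} → Extensional g → Extensional (with₀ g)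
  with₀-ext g-ext r f≗f′ = g-ext (suc r) λ { zero → ≡.refl ; (suc a) → ≡.cong suc (f≗f′ a) }

  pivotExpansion : ∀ {N k} → Weight N k → Vec (Fin N) (suc k) → Carrier
  pivotExpansion {k = k} g v = ∑[ β < suc k ] (sgn F (toℕ β) * g (lookup v β) (λ a → lookup v (punchIn β a)))

  pivotSum : ∀ {m k} → Weight (suc m) k → Fin (suc m) → Carrier
  pivotSum {m} {k} g r = sumOver (increasing F m k) (λ w → sgn F (signExp F w) * g r (λ a → punchIn r (lookup w a)))

  pivotExpansion-map-suc : ∀ {N k} (g : Weight (suc N) k) → Extensional g → (u : Vec (Fin N) (suc k)) →
                           pivotExpansion g (Vec.map suc u) ≈ pivotExpansion (avoid₀ g) u
  pivotExpansion-map-suc g g-ext u = sum-cong-≋ λ β → *-congˡ {sgn F (toℕ β)}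
    (weight-cong g-ext (lookup-map β suc u) (λ a → lookup-map (punchIn β a) suc u))

  pivotExpansion-zero∷ : ∀ {N k} (g : Weight (suc N) (suc k)) → Extensional g → (w : Vec (Fin N) (suc k)) →
    pivotExpansion g (zero Vec.∷ Vec.map suc w) ≈ g zero (λ a → suc (lookup w a)) + - pivotExpansion (with₀ g) w
  pivotExpansion-zero∷ {k = k} g g-ext w = +-cong pivot₀ (∑-negate _ later later-pivot)
    where
    pivot₀ : 1# * g zero (λ a → lookup (Vec.map suc w) a) ≈ g zero (λ a → suc (lookup w a))
    pivot₀ = trans (*-identityˡ _) (g-ext zero λ a → lookup-map a suc w)
    later : Vector Carrier (suc k)
    later β = sgn F (toℕ β) * with₀ g (lookup w β) (λ a → lookup w (punchIn β a))
    later-pivot : ∀ β → sgn F (suc (toℕ β)) * g (lookup (Vec.map suc w) β)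
                          (λ a → lookup (zero Vec.∷ Vec.map suc w) (punchIn (suc β) a)) ≈ - later β
    later-pivot β = trans (sym (-‿distribˡ-* _ _)) (-‿cong (*-congˡ
      (weight-cong g-ext (lookup-map β suc w) λ { zero → ≡.refl ; (suc a) → lookup-map (punchIn β a) suc w })))

  pivotSum-suc : ∀ {m k} (g : Weight (suc (suc m)) (suc k)) → Extensional g → (ρ : Fin (suc m)) →
                 pivotSum g (suc ρ) ≈ pivotSum (with₀ g) ρ + sgn F (suc k) * pivotSum (avoid₀ g) ρ
  pivotSum-suc {m} {k} g g-ext ρ = trans (sumOver-increasing-split term)
    (+-cong (sumOver-cong (increasing F m k) λ v →
               *-cong (reflexive (≡.cong (sgn F) (signExp-zero∷ v)))
                      (g-ext (suc ρ) {f′ = zero Vector.∷ λ a → suc (punchIn ρ (lookup v a))}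
                        λ { zero → ≡.refl ; (suc a) → ≡.cong (punchIn (suc ρ)) (lookup-map a suc v) }))
            (sumOver-signed-map-suc m (suc k) remaining (λ u → avoid₀ g ρ (λ a → punchIn ρ (lookup u a))) λ u →
               g-ext (suc ρ) λ a → ≡.cong (punchIn (suc ρ)) (lookup-map a suc u)))
    where
    remaining : Vec (Fin (suc m)) (suc k) → Carrier
    remaining w = g (suc ρ) (λ a → punchIn (suc ρ) (lookup w a))
    term : Vec (Fin (suc m)) (suc k) → Carrier
    term w = sgn F (signExp F w) * remaining w

  pivotSum-suc₀ : ∀ {m} (g : Weight (suc (suc m)) 0) → Extensional g → (ρ : Fin (suc m)) →
                  pivotSum g (suc ρ) ≈ pivotSum (avoid₀ g) ρ
  pivotSum-suc₀ g g-ext ρ = +-congʳ (*-congˡ (g-ext (suc ρ) λ ()))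

  signedExpansion : ∀ {N k} → Weight N k → Vec (Fin N) (suc k) → Carrier
  signedExpansion g v = sgn F (signExp F v) * pivotExpansion g v

  -- Both sides run over the pairs (increasing selection v, pivot position β in v), equivalently
  -- (pivot row r, increasing selection w of the other rows), with the same sign. Induction on
  -- the number of rows: split the selections according to whether they contain row 0.
  PivotExchange : ℕ → ℕ → Set (c ⊔ ℓ)
  PivotExchange m k = (g : Weight (suc m) k) → Extensional g →
    sumOver (increasing F (suc m) (suc k)) (signedExpansion g) ≈ ∑[ r < suc m ] (sgn F (toℕ r) * pivotSum g r)

  avoiding₀-part : ∀ {m k} → PivotExchange m k → (g : Weight (suc (suc m)) k) → Extensional g →
    sumOver (increasing F (suc m) (suc k)) (λ u → signedExpansion g (Vec.map suc u))
      ≈ sgn F (suc k) * ∑[ ρ < suc m ] (sgn F (toℕ ρ) * pivotSum (avoid₀ g) ρ)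
  avoiding₀-part {m} {k} exchange g g-ext = trans
    (sumOver-signed-map-suc (suc m) (suc k) (pivotExpansion g) (pivotExpansion (avoid₀ g)) (pivotExpansion-map-suc g g-ext))
    (*-congˡ (exchange (avoid₀ g) (avoid₀-ext g-ext)))

  pivotExchange-base : ∀ k → PivotExchange zero k
  pivotExchange-base zero    g g-ext = +-congʳ (*-congˡ (+-congʳ (*-congˡ (g-ext zero λ ()))))
  pivotExchange-base (suc k) g g-ext = sym (trans (+-identityʳ _) (zeroʳ _))

  pivotExchange-step₀ : ∀ {m} → PivotExchange m zero → PivotExchange (suc m) zero
  pivotExchange-step₀ {m} exchange g g-ext = trans (sumOver-increasing-split (signedExpansion g)) (+-cong
    (trans (+-identityʳ _) (*-congˡ (+-congʳ (*-congˡ (g-ext zero λ ())))))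
    (trans (avoiding₀-part exchange g g-ext) (trans (∑-sgn-shift 1# (pivotSum (avoid₀ g)))
      (sum-cong-≋ λ ρ → *-congˡ {sgn F (suc (toℕ ρ))} (trans (*-identityˡ _) (sym (pivotSum-suc₀ g g-ext ρ)))))))

  pivotExchange-stepₛ : ∀ {m k} → PivotExchange m (suc k) → PivotExchange m k → PivotExchange (suc m) (suc k)
  pivotExchange-stepₛ {m} {k} exchange exchange₀ g g-ext = begin
    sumOver (increasing F (suc (suc m)) (suc (suc k))) (signedExpansion g)
      ≈⟨ sumOver-increasing-split (signedExpansion g) ⟩
    containing + sumOver (increasing F (suc m) (suc (suc k))) (λ u → signedExpansion g (Vec.map suc u))
      ≈⟨ +-cong containing-part (avoiding₀-part exchange g g-ext) ⟩
    (pivotSum g zero + - ∑[ ρ < suc m ] (sgn F (toℕ ρ) * pivotSum (with₀ g) ρ))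
      + sgn F (suc (suc k)) * ∑[ ρ < suc m ] (sgn F (toℕ ρ) * pivotSum (avoid₀ g) ρ)
      ≈⟨ +-assoc _ _ _ ⟩
    pivotSum g zero + (- ∑[ ρ < suc m ] (sgn F (toℕ ρ) * pivotSum (with₀ g) ρ)
      + sgn F (suc (suc k)) * ∑[ ρ < suc m ] (sgn F (toℕ ρ) * pivotSum (avoid₀ g) ρ))
      ≈⟨ +-cong (sym (*-identityˡ _)) (trans (∑-sgn-shift-+ (sgn F (suc k)) (pivotSum (with₀ g)) (pivotSum (avoid₀ g)))
           (sum-cong-≋ λ ρ → *-congˡ {sgn F (suc (toℕ ρ))} (sym (pivotSum-suc g g-ext ρ)))) ⟩
    ∑[ r < suc (suc m) ] (sgn F (toℕ r) * pivotSum g r) ∎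
    where
    containing : Carrier
    containing = sumOver (increasing F (suc m) (suc k))
                   (λ w → sgn F (signExp F (zero Vec.∷ Vec.map suc w)) * pivotExpansion g (zero Vec.∷ Vec.map suc w))
    containing-part : containing ≈ pivotSum g zero + - ∑[ ρ < suc m ] (sgn F (toℕ ρ) * pivotSum (with₀ g) ρ)
    containing-part = begin
      containing
        ≈⟨ sumOver-cong (increasing F (suc m) (suc k)) (λ w →
             trans (*-cong (reflexive (≡.cong (sgn F) (signExp-zero∷ w))) (pivotExpansion-zero∷ g g-ext w))
                   (trans (distribˡ _ _ _) (+-congˡ (sym (-‿distribʳ-* _ _))))) ⟩
      sumOver (increasing F (suc m) (suc k))
        (λ w → sgn F (signExp F w) * g zero (λ a → suc (lookup w a)) + - (sgn F (signExp F w) * pivotExpansion (with₀ g) w))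
        ≈⟨ sumOver-distrib-+ (increasing F (suc m) (suc k)) _ _ ⟩
      pivotSum g zero + sumOver (increasing F (suc m) (suc k)) (λ w → - (sgn F (signExp F w) * pivotExpansion (with₀ g) w))
        ≈⟨ +-congˡ (trans (sym (-‿distrib-sumOver (increasing F (suc m) (suc k)) _))
                          (-‿cong (exchange₀ (with₀ g) (with₀-ext g-ext)))) ⟩
      pivotSum g zero + - ∑[ ρ < suc m ] (sgn F (toℕ ρ) * pivotSum (with₀ g) ρ) ∎

  pivotExchange : ∀ m k → PivotExchange m k
  pivotExchange zero    k       = pivotExchange-base k
  pivotExchange (suc m) zero    = pivotExchange-step₀ (pivotExchange m zero)
  pivotExchange (suc m) (suc k) = pivotExchange-stepₛ (pivotExchange m (suc k)) (pivotExchange m k)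

  cullis-expansion : ∀ {m k} (X : Mat F (suc m) (suc k)) →
                     cullis F X ≈ ∑[ r < suc m ] (sgn F (toℕ r) * (X r zero * cullis F (minor r X)))
  cullis-expansion {m} {k} X = begin
    cullis F X
      ≈⟨ sumOver-cong (increasing F (suc m) (suc k)) (λ v → *-congˡ (reflexive (sumFin≡sum (expansion v)))) ⟩
    sumOver (increasing F (suc m) (suc k)) (signedExpansion g)
      ≈⟨ pivotExchange m k g g-ext ⟩
    ∑[ r < suc m ] (sgn F (toℕ r) * pivotSum g r)
      ≈⟨ sum-cong-≋ (λ r → *-congˡ {sgn F (toℕ r)} (trans
           (sumOver-cong (increasing F m k) λ w → x∙yz≈y∙xz (sgn F (signExp F w)) (X r zero) (minorDet r w))
           (sym (*-distribˡ-sumOver (increasing F m k) (X r zero) λ w → sgn F (signExp F w) * minorDet r w)))) ⟩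
    ∑[ r < suc m ] (sgn F (toℕ r) * (X r zero * cullis F (minor r X))) ∎
    where
    g : Weight (suc m) k
    g r f = X r zero * det F (λ a b → X (f a) (suc b))
    g-ext : Extensional g
    g-ext r f≗f′ = *-congˡ (det-cong λ a b → reflexive (≡.cong (λ r′ → X r′ (suc b)) (f≗f′ a)))
    minorDet : Fin (suc m) → Vec (Fin m) k → Carrier
    minorDet r w = det F (rowsSub F w (minor r X))
    expansion : Vec (Fin (suc m)) (suc k) → Vector Carrier (suc k)
    expansion v β = sgn F (toℕ β) * g (lookup v β) (λ a → lookup v (punchIn β a))

  cullis≈laplace : ∀ {n k} (X : Mat F n k) → cullis F X ≈ laplace X
  cullis≈laplace {n}     {zero}  X = trans (+-identityʳ _) (*-identityˡ _)
  cullis≈laplace {zero}  {suc k} X = refl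
  cullis≈laplace {suc m} {suc k} X = trans (cullis-expansion X) (sum-cong-≋ λ r →
    *-congˡ {sgn F (toℕ r)} (*-congˡ {X r zero} (cullis≈laplace (minor r X))))

  -- Column operations

  permuteCols : ∀ {n k} → (Fin k → Fin k) → Mat F n k → Mat F n k
  permuteCols π X r s = X r (π s)

  fixing₀ : ∀ {k} → (Fin k → Fin k) → Fin (suc k) → Fin (suc k)
  fixing₀ π zero    = zero
  fixing₀ π (suc s) = suc (π s)

  laplace-fixing₀ : ∀ {k} {π : Fin k → Fin k} →
    (∀ {n} (Y : Mat F n k) → laplace (permuteCols π Y) ≈ - laplace Y) →
    ∀ {n} (X : Mat F n (suc k)) → laplace (permuteCols (fixing₀ π) X) ≈ - laplace X
  laplace-fixing₀ negates {zero}  X = sym -0#≈0#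
  laplace-fixing₀ negates {suc n} X = ∑-negate-terms (λ r → sgn F (toℕ r)) _
    (λ r → X r zero * laplace (minor r X))
    (λ r → trans (*-congˡ (negates (minor r X))) (sym (-‿distribʳ-* _ _)))

  -- Deleting row r and then row r′ of what remains deletes the same two rows as
  -- deleting proj₁ (swapPair r r′) and then proj₂ (swapPair r r′).
  swapPair : ∀ {m} → Fin (suc m) → Fin m → Fin (suc m) × Fin m
  swapPair {suc m} zero    r′      = suc r′ , zero
  swapPair {suc m} (suc ρ) zero    = zero , ρ
  swapPair {suc m} (suc ρ) (suc t) = Product.map suc suc (swapPair ρ t)

  proj₁-swapPair : ∀ {m} (r : Fin (suc m)) (r′ : Fin m) → proj₁ (swapPair r r′) ≡ punchIn r r′
  proj₁-swapPair {suc m} zero    r′      = ≡.refl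
  proj₁-swapPair {suc m} (suc ρ) zero    = ≡.refl
  proj₁-swapPair {suc m} (suc ρ) (suc t) = ≡.cong suc (proj₁-swapPair ρ t)

  punchIn-swapPair : ∀ {m} (r : Fin (suc m)) (r′ : Fin m) →
                     punchIn (proj₁ (swapPair r r′)) (proj₂ (swapPair r r′)) ≡ r
  punchIn-swapPair {suc m} zero    r′      = ≡.refl
  punchIn-swapPair {suc m} (suc ρ) zero    = ≡.refl
  punchIn-swapPair {suc m} (suc ρ) (suc t) = ≡.cong suc (punchIn-swapPair ρ t)

  punchIn²-swapPair : ∀ {m} (r : Fin (suc (suc m))) (r′ : Fin (suc m)) (x : Fin m) →
    punchIn r (punchIn r′ x) ≡ punchIn (proj₁ (swapPair r r′)) (punchIn (proj₂ (swapPair r r′)) x)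
  punchIn²-swapPair zero    r′      x       = ≡.refl
  punchIn²-swapPair (suc ρ) zero    x       = ≡.refl
  punchIn²-swapPair (suc ρ) (suc t) zero    = ≡.refl
  punchIn²-swapPair (suc ρ) (suc t) (suc x) = ≡.cong suc (punchIn²-swapPair ρ t x)

  sgn-swapPair : ∀ {m} (r : Fin (suc m)) (r′ : Fin m) →
    sgn F (toℕ (proj₁ (swapPair r r′))) * sgn F (toℕ (proj₂ (swapPair r r′))) ≈ - (sgn F (toℕ r) * sgn F (toℕ r′))
  sgn-swapPair {suc m} zero    r′      = trans (*-identityʳ _) (-‿cong (sym (*-identityˡ _)))
  sgn-swapPair {suc m} (suc ρ) zero    =
    trans (*-identityˡ _) (trans (sym (-‿involutive _)) (-‿cong (sym (*-identityʳ _))))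
  sgn-swapPair {suc m} (suc ρ) (suc t) =
    trans (-x*-y≈x*y _ _) (trans (sgn-swapPair ρ t) (-‿cong (sym (-x*-y≈x*y _ _))))

  ∑∑-swapPair : ∀ m (Ψ : Fin (suc m) → Fin m → Carrier) →
    ∑[ r < suc m ] ∑[ r′ < m ] Ψ r r′
      ≈ ∑[ r < suc m ] ∑[ r′ < m ] Ψ (proj₁ (swapPair r r′)) (proj₂ (swapPair r r′))
  ∑∑-swapPair zero    Ψ = refl
  ∑∑-swapPair (suc m) Ψ = begin
    A + ∑[ ρ < suc m ] (Ψ (suc ρ) zero + ∑[ t < m ] Ψ (suc ρ) (suc t))
      ≈⟨ +-congˡ (∑-distrib-+ (λ ρ → Ψ (suc ρ) zero) (λ ρ → ∑[ t < m ] Ψ (suc ρ) (suc t))) ⟩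
    A + (B + ∑[ ρ < suc m ] ∑[ t < m ] Ψ (suc ρ) (suc t))
      ≈⟨ +-congˡ (+-congˡ (∑∑-swapPair m (λ ρ t → Ψ (suc ρ) (suc t)))) ⟩
    A + (B + D)
      ≈⟨ x+[y+z]≈y+[x+z] A B D ⟩
    B + (A + D)
      ≈⟨ +-congˡ (∑-distrib-+ (λ ρ → Ψ zero ρ) (λ ρ → ∑[ t < m ] Ψ′ ρ t)) ⟨
    B + ∑[ ρ < suc m ] (Ψ zero ρ + ∑[ t < m ] Ψ′ ρ t) ∎
    where
    Ψ′ : Fin (suc m) → Fin m → Carrier
    Ψ′ ρ t = Ψ (suc (proj₁ (swapPair ρ t))) (suc (proj₂ (swapPair ρ t)))
    A = ∑[ r′ < suc m ] Ψ zero r′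
    B = ∑[ ρ < suc m ] Ψ (suc ρ) zero
    D = ∑[ ρ < suc m ] ∑[ t < m ] Ψ′ ρ t

  secondOrderTerm : ∀ {m k} → Mat F (suc (suc m)) (suc (suc k)) → Fin (suc (suc m)) → Fin (suc m) → Carrier
  secondOrderTerm Y r r′ = (sgn F (toℕ r) * sgn F (toℕ r′))
    * ((Y r zero * Y (punchIn r r′) (suc zero)) * laplace (minor r′ (minor r Y)))

  laplace-expansion₂ : ∀ {m k} (Y : Mat F (suc (suc m)) (suc (suc k))) →
                       laplace Y ≈ ∑[ r < suc (suc m) ] ∑[ r′ < suc m ] secondOrderTerm Y r r′
  laplace-expansion₂ {m} Y = sum-cong-≋ λ r → begin
    sgn F (toℕ r) * (Y r zero * ∑[ r′ < suc m ] (sgn F (toℕ r′) * (Y (punchIn r r′) (suc zero) * L r r′)))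
      ≈⟨ *-congˡ (*-distribˡ-sum (Y r zero) (λ r′ → sgn F (toℕ r′) * (Y (punchIn r r′) (suc zero) * L r r′))) ⟩
    sgn F (toℕ r) * ∑[ r′ < suc m ] (Y r zero * (sgn F (toℕ r′) * (Y (punchIn r r′) (suc zero) * L r r′)))
      ≈⟨ *-distribˡ-sum (sgn F (toℕ r)) (λ r′ → Y r zero * (sgn F (toℕ r′) * (Y (punchIn r r′) (suc zero) * L r r′)))
       ⟩
    ∑[ r′ < suc m ] (sgn F (toℕ r) * (Y r zero * (sgn F (toℕ r′) * (Y (punchIn r r′) (suc zero) * L r r′))))
      ≈⟨ sum-cong-≋ (λ r′ → regroup (sgn F (toℕ r)) (Y r zero) (sgn F (toℕ r′)) (Y (punchIn r r′) (suc zero)) (L r r′))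
       ⟩
    ∑[ r′ < suc m ] secondOrderTerm Y r r′ ∎
    where
    L : Fin (suc (suc m)) → Fin (suc m) → Carrier
    L r r′ = laplace (minor r′ (minor r Y))
    regroup : ∀ s x t y z → s * (x * (t * (y * z))) ≈ (s * t) * ((x * y) * z)
    regroup = solve 5 (λ s x t y z → s ⊕ (x ⊕ (t ⊕ (y ⊕ z))) ⊜ (s ⊕ t) ⊕ ((x ⊕ y) ⊕ z)) refl

  laplace-swap₀₁ : ∀ {n k} (X : Mat F n (suc (suc k))) → laplace (permuteCols (swapCol F (suc zero)) X) ≈ - laplace X
  laplace-swap₀₁ {zero}        X = sym -0#≈0#
  laplace-swap₀₁ {suc zero}    X = trans (vanishes _) (trans (sym -0#≈0#) (-‿cong (sym (vanishes _))))
    where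
    vanishes : ∀ x → 1# * (x * 0#) + 0# ≈ 0#
    vanishes x = trans (+-identityʳ _) (trans (*-identityˡ _) (zeroʳ x))
  laplace-swap₀₁ {suc (suc m)} X = begin
    laplace X′
      ≈⟨ laplace-expansion₂ X′ ⟩
    ∑[ r < suc (suc m) ] ∑[ r′ < suc m ] secondOrderTerm X′ r r′
      ≈⟨ ∑∑-swapPair (suc m) (secondOrderTerm X′) ⟩
    ∑[ r < suc (suc m) ] ∑[ r′ < suc m ] secondOrderTerm X′ (proj₁ (swapPair r r′)) (proj₂ (swapPair r r′))
      ≈⟨ ∑-negate _ (λ r → ∑[ r′ < suc m ] secondOrderTerm X r r′)
                    (λ r → ∑-negate _ (secondOrderTerm X r) (swapped r)) ⟩
    - ∑[ r < suc (suc m) ] ∑[ r′ < suc m ] secondOrderTerm X r r′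
      ≈⟨ -‿cong (laplace-expansion₂ X) ⟨
    - laplace X ∎
    where
    X′ = permuteCols (swapCol F (suc zero)) X
    swapped : ∀ r r′ →
              secondOrderTerm X′ (proj₁ (swapPair r r′)) (proj₂ (swapPair r r′)) ≈ - secondOrderTerm X r r′
    swapped r r′ = trans
      (*-cong (sgn-swapPair r r′)
        (*-cong (*-cong (reflexive (≡.cong (λ q → X q (suc zero)) (proj₁-swapPair r r′)))
                        (reflexive (≡.cong (λ q → X q zero) (punchIn-swapPair r r′))))
                (laplace-cong λ a b → reflexive (≡.cong (λ q → X q (suc (suc b))) (≡.sym (punchIn²-swapPair r r′ a))))))
      (trans (sym (-‿distribˡ-* _ _)) (-‿cong (*-congˡ (*-congʳ (*-comm _ _)))))

  -- (0 b+2) = (0 1) ∘ (1 b+2) ∘ (0 1), and (1 b+2) fixes the first column.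
  swapCol-conjugate : ∀ {k} (b : Fin k) (s : Fin (suc (suc k))) →
    swapCol F (suc (suc b)) s ≡ swapCol F (suc zero) (fixing₀ (swapCol F (suc b)) (swapCol F (suc zero) s))
  swapCol-conjugate b zero          = ≡.refl
  swapCol-conjugate b (suc zero)    = ≡.refl
  swapCol-conjugate b (suc (suc t)) with t Fin.≟ b
  ... | yes ≡.refl = ≡.refl
  ... | no _       = ≡.refl

  laplace-swapCol : ∀ {k} (j : Fin k) {n} (X : Mat F n (suc k)) →
                    laplace (permuteCols (swapCol F (suc j)) X) ≈ - laplace X
  laplace-swapCol zero    X = laplace-swap₀₁ X
  laplace-swapCol (suc b) X = begin
    laplace (permuteCols (swapCol F (suc (suc b))) X)
      ≈⟨ laplace-cong (λ r s → reflexive (≡.cong (X r) (swapCol-conjugate b s))) ⟩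
    laplace (permuteCols σ (permuteCols (fixing₀ (swapCol F (suc b))) (permuteCols σ X)))
      ≈⟨ laplace-swap₀₁ (permuteCols (fixing₀ (swapCol F (suc b))) (permuteCols σ X)) ⟩
    - laplace (permuteCols (fixing₀ (swapCol F (suc b))) (permuteCols σ X))
      ≈⟨ -‿cong (laplace-fixing₀ (laplace-swapCol b) (permuteCols σ X)) ⟩
    - - laplace (permuteCols σ X)
      ≈⟨ -‿involutive _ ⟩
    laplace (permuteCols σ X)
      ≈⟨ laplace-swap₀₁ X ⟩
    - laplace X ∎
    where
    σ = swapCol F (suc zero)

  -- Steps (3)–(4) of S.
  swapAndSign : ∀ {n k} → Fin k → Mat F n k → Mat F n k
  swapAndSign j X r s = colSign F j s * X r (swapCol F j s)

  laplace-swapAndSign : ∀ {n k} (j : Fin k) (X : Mat F n k) → laplace (swapAndSign j X) ≈ laplace X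
  laplace-swapAndSign zero    X = laplace-cong {Y = X} λ r → λ
    { zero    → *-identityˡ _
    ; (suc s) → *-identityˡ _ }
  laplace-swapAndSign (suc j) X = begin
    laplace (swapAndSign (suc j) X)
      ≈⟨ laplace-negate-column₀ {X = permuteCols (swapCol F (suc j)) X} (λ r → -1*x≈-x _) (λ r s → *-identityˡ _) ⟩
    - laplace (permuteCols (swapCol F (suc j)) X)
      ≈⟨ -‿cong (laplace-swapCol j X) ⟩
    - - laplace X
      ≈⟨ -‿involutive _ ⟩
    laplace X ∎

  -- Row operations

  -- The row below r, numbered among the rows after the first one.
  rowBelow : ∀ {m} → Fin (suc m) → Maybe (Fin m)
  rowBelow {zero}  zero    = nothing
  rowBelow {suc m} zero    = just zero
  rowBelow {suc m} (suc r) = Maybe.map suc (rowBelow r)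

  -- Steps (1)–(2) of S for i = 2.
  rotateUp : ∀ {m k} → Mat F (suc m) k → Mat F (suc m) k
  rotateUp Y r s = maybe′ (λ r′ → Y (suc r′) s) (- Y zero s) (rowBelow r)

  rowBelow-inject₁ : ∀ {m} (i : Fin m) → rowBelow (inject₁ i) ≡ just i
  rowBelow-inject₁ {suc m} zero    = ≡.refl
  rowBelow-inject₁ {suc m} (suc i) = ≡.cong (Maybe.map suc) (rowBelow-inject₁ i)

  rowBelow-last : ∀ m → rowBelow (fromℕ m) ≡ nothing
  rowBelow-last zero    = ≡.refl
  rowBelow-last (suc m) = ≡.cong (Maybe.map suc) (rowBelow-last m)

  rowBelow-punchIn : ∀ {m} (i a : Fin (suc m)) →
                     rowBelow (punchIn (inject₁ i) a) ≡ Maybe.map (punchIn i) (rowBelow a)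
  rowBelow-punchIn zero            a       = ≡.refl
  rowBelow-punchIn {suc m} (suc i) zero    = ≡.refl
  rowBelow-punchIn {suc m} (suc i) (suc a) = ≡.trans (≡.cong (Maybe.map suc) (rowBelow-punchIn i a))
    (≡.trans (≡.sym (map-∘ (rowBelow a))) (map-∘ (rowBelow a)))

  punchIn-last : ∀ {m} (a : Fin m) → punchIn (fromℕ m) a ≡ inject₁ a
  punchIn-last {suc m} zero    = ≡.refl
  punchIn-last {suc m} (suc a) = ≡.cong suc (punchIn-last a)

  rotateUp-inject₁ : ∀ {m k} (Y : Mat F (suc m) k) (i : Fin m) s → rotateUp Y (inject₁ i) s ≡ Y (suc i) s
  rotateUp-inject₁ Y i s = ≡.cong (maybe′ (λ r′ → Y (suc r′) s) (- Y zero s)) (rowBelow-inject₁ i)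

  rotateUp-last : ∀ {m k} (Y : Mat F (suc m) k) s → rotateUp Y (fromℕ m) s ≡ - Y zero s
  rotateUp-last {m} Y s = ≡.cong (maybe′ (λ r′ → Y (suc r′) s) (- Y zero s)) (rowBelow-last m)

  minor-rotateUp-inject₁ : ∀ {m k} (i : Fin (suc m)) (Y : Mat F (suc (suc m)) (suc k)) →
                           _≈M_ F (minor (inject₁ i) (rotateUp Y)) (rotateUp (minor (suc i) Y))
  minor-rotateUp-inject₁ i Y a b = reflexive (≡.trans
    (≡.cong (maybe′ (λ r′ → Y (suc r′) (suc b)) (- Y zero (suc b))) (rowBelow-punchIn i a))
    (maybe′-map _ _ (punchIn i) (rowBelow a)))

  minor-rotateUp-last : ∀ {m k} (Y : Mat F (suc m) (suc k)) →
                        _≈M_ F (minor (fromℕ m) (rotateUp Y)) (minor zero Y)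
  minor-rotateUp-last Y a b = reflexive (≡.trans (≡.cong (λ q → rotateUp Y q (suc b)) (punchIn-last a))
                                                  (rotateUp-inject₁ Y a (suc b)))

  -- Induction on k: along the first column, the minors of rotateUp Y are rotations again.
  laplace-rotateUp : ∀ {m k} → sgn F (suc m) ≈ sgn F k → (Y : Mat F (suc m) k) →
                     laplace (rotateUp Y) ≈ sgn F k * laplace Y
  laplace-rotateUp {m} {zero}  _      Y = sym (*-identityˡ 1#)
  laplace-rotateUp {m} {suc k} parity Y = begin
    laplace (rotateUp Y)
      ≈⟨ sum-init-last (term (rotateUp Y)) ⟩
    ∑[ i < m ] term (rotateUp Y) (inject₁ i) + term (rotateUp Y) (fromℕ m)
      ≈⟨ +-cong (rotated-rows m parity Y) last-row ⟩
    ∑[ i < m ] (sgn F (suc k) * term Y (suc i)) + sgn F (suc k) * term Y zero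
      ≈⟨ +-congʳ (*-distribˡ-sum (sgn F (suc k)) (λ i → term Y (suc i))) ⟨
    sgn F (suc k) * ∑[ i < m ] term Y (suc i) + sgn F (suc k) * term Y zero
      ≈⟨ trans (+-comm _ _) (sym (distribˡ _ _ _)) ⟩
    sgn F (suc k) * laplace Y ∎
    where
    term : ∀ {m} → Mat F (suc m) (suc k) → Fin (suc m) → Carrier
    term Y r = sgn F (toℕ r) * (Y r zero * laplace (minor r Y))

    last-row : term (rotateUp Y) (fromℕ m) ≈ sgn F (suc k) * term Y zero
    last-row = begin
      sgn F (toℕ (fromℕ m)) * (rotateUp Y (fromℕ m) zero * laplace (minor (fromℕ m) (rotateUp Y)))
        ≈⟨ *-cong (reflexive (≡.cong (sgn F) (Fin.toℕ-fromℕ m)))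
                  (*-cong (reflexive (rotateUp-last Y zero)) (laplace-cong (minor-rotateUp-last Y))) ⟩
      sgn F m * (- Y zero zero * laplace (minor zero Y))
        ≈⟨ trans (*-congˡ (sym (-‿distribˡ-* _ _))) (sym (-‿distribʳ-* _ _)) ⟩
      - (sgn F m * (Y zero zero * laplace (minor zero Y)))
        ≈⟨ -‿distribˡ-* _ _ ⟩
      sgn F (suc m) * (Y zero zero * laplace (minor zero Y))
        ≈⟨ *-cong parity (sym (*-identityˡ _)) ⟩
      sgn F (suc k) * term Y zero ∎

    rotated-rows : ∀ m → sgn F (suc m) ≈ sgn F (suc k) → (Y : Mat F (suc m) (suc k)) →
                   ∑[ i < m ] term (rotateUp Y) (inject₁ i) ≈ ∑[ i < m ] (sgn F (suc k) * term Y (suc i))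
    rotated-rows zero    parity Y = refl
    rotated-rows (suc m) parity Y = sum-cong-≋ λ i → begin
      sgn F (toℕ (inject₁ i)) * (rotateUp Y (inject₁ i) zero * laplace (minor (inject₁ i) (rotateUp Y)))
        ≈⟨ *-cong (reflexive (≡.cong (sgn F) (Fin.toℕ-inject₁ i)))
                  (*-cong (reflexive (rotateUp-inject₁ Y i zero))
                          (trans (laplace-cong (minor-rotateUp-inject₁ i Y))
                                 (laplace-rotateUp (-‿injective parity) (minor (suc i) Y)))) ⟩
      sgn F (toℕ i) * (Y (suc i) zero * (sgn F k * laplace (minor (suc i) Y)))
        ≈⟨ trans (*-congˡ (x∙yz≈y∙xz _ _ _)) (x∙yz≈y∙xz _ _ _) ⟩
      sgn F k * (sgn F (toℕ i) * (Y (suc i) zero * laplace (minor (suc i) Y)))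
        ≈⟨ trans (*-congˡ (sym (-‿distribˡ-* (sgn F (toℕ i)) _))) (-x*-y≈x*y (sgn F k) _) ⟨
      sgn F (suc k) * term Y (suc i) ∎

  laplace-rotateUp-fold : ∀ {m k} → sgn F (suc m) ≈ sgn F k → ∀ t (Y : Mat F (suc m) k) →
                          laplace (fold Y rotateUp t) ≈ sgn F (t ℕ.* k) * laplace Y
  laplace-rotateUp-fold parity zero    Y = sym (*-identityˡ _)
  laplace-rotateUp-fold {k = k} parity (suc t) Y = begin
    laplace (rotateUp (fold Y rotateUp t))       ≈⟨ laplace-rotateUp parity (fold Y rotateUp t) ⟩
    sgn F k * laplace (fold Y rotateUp t)        ≈⟨ *-congˡ (laplace-rotateUp-fold parity t Y) ⟩
    sgn F k * (sgn F (t ℕ.* k) * laplace Y)      ≈⟨ *-assoc _ _ _ ⟨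
    sgn F k * sgn F (t ℕ.* k) * laplace Y        ≈⟨ *-congʳ (sgn-+ k (t ℕ.* k)) ⟨
    sgn F (suc t ℕ.* k) * laplace Y              ∎

  toℕ-rowBelow-just : ∀ {m} (r : Fin (suc m)) {r′} → rowBelow r ≡ just r′ → toℕ r ≡ toℕ r′
  toℕ-rowBelow-just {suc m} zero    ≡.refl = ≡.refl
  toℕ-rowBelow-just {suc m} (suc r) eq with rowBelow r in eq′
  toℕ-rowBelow-just {suc m} (suc r) ≡.refl | just r′ = ≡.cong suc (toℕ-rowBelow-just r eq′)

  toℕ-rowBelow-nothing : ∀ {m} (r : Fin (suc m)) → rowBelow r ≡ nothing → toℕ r ≡ m
  toℕ-rowBelow-nothing {zero}  zero    eq = ≡.refl
  toℕ-rowBelow-nothing {suc m} (suc r) eq with rowBelow r in eq′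
  ... | nothing = ≡.cong suc (toℕ-rowBelow-nothing r eq′)

  rotateUp-fold-entry : ∀ {m k} (Y : Mat F (suc m) k) t (r q : Fin (suc m)) s →
    (toℕ q ≡ t ℕ.+ toℕ r → fold Y rotateUp t r s ≈ Y q s) ×
    (toℕ q ℕ.+ suc m ≡ t ℕ.+ toℕ r → fold Y rotateUp t r s ≈ - Y q s)
  rotateUp-fold-entry {m} Y zero r q s =
    (λ q≡r → reflexive (≡.cong (λ p → Y p s) (Fin.toℕ-injective (≡.sym q≡r)))) ,
    (λ q+n≡r → contradiction (≡.subst (suc m ℕ.≤_) q+n≡r (ℕ.m≤n+m (suc m) (toℕ q))) (ℕ.<⇒≱ (Fin.toℕ<n r)))
  rotateUp-fold-entry {m} Y (suc t) r q s with rowBelow r in below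
  ... | just r′ = (λ q≡ → proj₁ (rotateUp-fold-entry Y t (suc r′) q s) (≡.trans q≡ shift)) ,
                  (λ q+n≡ → proj₂ (rotateUp-fold-entry Y t (suc r′) q s) (≡.trans q+n≡ shift))
    where
    shift : suc t ℕ.+ toℕ r ≡ t ℕ.+ toℕ (suc r′)
    shift = ≡.trans (≡.cong (λ x → suc (t ℕ.+ x)) (toℕ-rowBelow-just r below)) (≡.sym (ℕ.+-suc t (toℕ r′)))
  ... | nothing =
    (λ q≡ → contradiction (≡.subst (suc m ℕ.≤_) (≡.sym (≡.trans q≡ r-last)) (ℕ.s≤s (ℕ.m≤n+m m t)))
                          (ℕ.<⇒≱ (Fin.toℕ<n q))) ,
    (λ q+n≡ → -‿cong (proj₁ (rotateUp-fold-entry Y t zero q s)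
                 (≡.trans (ℕ.+-cancelʳ-≡ (suc m) (toℕ q) t (≡.trans q+n≡ (≡.trans r-last (≡.sym (ℕ.+-suc t m)))))
                          (≡.sym (ℕ.+-identityʳ t)))))
    where
    r-last : suc t ℕ.+ toℕ r ≡ suc t ℕ.+ m
    r-last = ≡.cong (suc t ℕ.+_) (toℕ-rowBelow-nothing r below)

  -- Steps (1)–(2) of S.
  cyclicShift : ∀ {n k} → Fin n → Mat F n k → Mat F n k
  cyclicShift i Y r s = proj₂ (cycRow F i r) * Y (proj₁ (cycRow F i r)) s

  cyclicShift≈rotateUp-fold : ∀ {m k} (i : Fin (suc m)) (Y : Mat F (suc m) k) →
                              _≈M_ F (cyclicShift i Y) (fold Y rotateUp (toℕ i))
  cyclicShift≈rotateUp-fold {m} i Y r s with toℕ i ℕ.+ toℕ r ℕ.<? suc m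
  ... | yes i+r<n = trans (*-identityˡ _) (sym (proj₁ (rotateUp-fold-entry Y (toℕ i) r _ s) (Fin.toℕ-fromℕ< i+r<n)))
  ... | no  i+r≮n = trans (-1*x≈-x _) (sym (proj₂ (rotateUp-fold-entry Y (toℕ i) r _ s)
          (≡.trans (≡.cong (ℕ._+ suc m) (Fin.toℕ-fromℕ< _)) (ℕ.m∸n+n≡m (ℕ.≮⇒≥ i+r≮n)))))

  -- Invariance of the Cullis determinant

  cullis-S : ∀ {m k} → 2 ∣ suc m ℕ.+ k → (i : Fin (suc m)) (j : Fin k) (X : Mat F (suc m) k) →
             cullis F (S F i j X) ≈ cullis F X
  cullis-S {m} {k} 2∣n+k i j X = begin
    cullis F (S F i j X)
      ≈⟨ cullis≈laplace (S F i j X) ⟩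
    laplace (S F i j X)
      ≈⟨ laplace-cong {Y = λ r s → sgn F e * cyclicShift i Z r s} (λ r s → *-congˡ (x∙yz≈y∙xz _ _ _)) ⟩
    laplace (λ r s → sgn F e * cyclicShift i Z r s)
      ≈⟨ laplace-scale (sgn F e) (cyclicShift i Z) ⟩
    sgn F e ^ k * laplace (cyclicShift i Z)
      ≈⟨ *-cong (sgn-^ e k) (laplace-cong (cyclicShift≈rotateUp-fold i Z)) ⟩
    sgn F (k ℕ.* e) * laplace (fold Z rotateUp (toℕ i))
      ≈⟨ *-congˡ (laplace-rotateUp-fold (sgn-parity (suc m) k 2∣n+k) (toℕ i) Z) ⟩
    sgn F (k ℕ.* e) * (sgn F (toℕ i ℕ.* k) * laplace Z)
      ≈⟨ *-congˡ (*-congˡ (laplace-swapAndSign j X)) ⟩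
    sgn F (k ℕ.* e) * (sgn F (toℕ i ℕ.* k) * laplace X)
      ≈⟨ trans (sym (*-assoc _ _ _)) (*-congʳ (sym (sgn-+ (k ℕ.* e) (toℕ i ℕ.* k)))) ⟩
    sgn F (k ℕ.* e ℕ.+ toℕ i ℕ.* k) * laplace X
      ≈⟨ *-congʳ (trans (reflexive (≡.cong (sgn F) exponent)) (sgn-even (2∣1+m+k⇒2∣k*m m k 2∣n+k))) ⟩
    1# * laplace X
      ≈⟨ trans (*-identityˡ _) (sym (cullis≈laplace X)) ⟩
    cullis F X ∎
    where
    e = m ℕ.∸ toℕ i
    Z = swapAndSign j X
    exponent : k ℕ.* e ℕ.+ toℕ i ℕ.* k ≡ k ℕ.* m
    exponent = ≡.trans (≡.cong (k ℕ.* e ℕ.+_) (ℕ.*-comm (toℕ i) k))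
                 (≡.trans (≡.sym (ℕ.*-distribˡ-+ k e (toℕ i)))
                          (≡.cong (k ℕ.*_) (ℕ.m∸n+n≡m (ℕ.s≤s⁻¹ (Fin.toℕ<n i)))))

  -- Linearity and invertibility of S

  monomialMap : ∀ {n k} → Carrier → (Fin k → Carrier) → (Fin n → Carrier) → (Fin n → Fin n) → (Fin k → Fin k) →
                Mat F n k → Mat F n k
  monomialMap e c σ ρ κ X r s = e * (c s * (σ r * X (ρ r) (κ s)))

  monomialMap-isLinear : ∀ {n k} e c σ ρ κ → IsLinear F (monomialMap {n} {k} e c σ ρ κ)
  monomialMap-isLinear e c σ ρ κ =
    (λ X Y r s → trans (*-congˡ (trans (*-congˡ (distribˡ (σ r) _ _)) (distribˡ (c s) _ _))) (distribˡ e _ _)) ,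
    (λ a X r s → regroup a e (c s) (σ r) (X (ρ r) (κ s)))
    where
    regroup : ∀ a e c σ x → e * (c * (σ * (a * x))) ≈ a * (e * (c * (σ * x)))
    regroup = solve 5 (λ a e c σ x → e ⊕ (c ⊕ (σ ⊕ (a ⊕ x))) ⊜ a ⊕ (e ⊕ (c ⊕ (σ ⊕ x)))) refl

  monomialMap-inverseˡ : ∀ {n k} e c σ ρ κ e′ c′ σ′ ρ′ κ′ →
    e * e′ ≈ 1# → (∀ s → c s * c′ (κ s) ≈ 1#) → (∀ r → σ r * σ′ (ρ r) ≈ 1#) →
    (∀ r → ρ′ (ρ r) ≡ r) → (∀ s → κ′ (κ s) ≡ s) →
    ∀ (X : Mat F n k) → _≈M_ F (monomialMap e c σ ρ κ (monomialMap e′ c′ σ′ ρ′ κ′ X)) X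
  monomialMap-inverseˡ e c σ ρ κ e′ c′ σ′ ρ′ κ′ ee′ cc′ σσ′ ρ′ρ κ′κ X r s = begin
    e * (c s * (σ r * (e′ * (c′ (κ s) * (σ′ (ρ r) * X (ρ′ (ρ r)) (κ′ (κ s)))))))
      ≈⟨ regroup e (c s) (σ r) e′ (c′ (κ s)) (σ′ (ρ r)) _ ⟩
    (e * e′) * ((c s * c′ (κ s)) * ((σ r * σ′ (ρ r)) * X (ρ′ (ρ r)) (κ′ (κ s))))
      ≈⟨ *-cong ee′ (*-cong (cc′ s) (*-cong (σσ′ r) (reflexive (≡.cong₂ X (ρ′ρ r) (κ′κ s))))) ⟩
    1# * (1# * (1# * X r s))
      ≈⟨ trans (*-identityˡ _) (trans (*-identityˡ _) (*-identityˡ _)) ⟩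
    X r s ∎
    where
    regroup : ∀ e c σ e′ c′ σ′ x →
              e * (c * (σ * (e′ * (c′ * (σ′ * x))))) ≈ (e * e′) * ((c * c′) * ((σ * σ′) * x))
    regroup = solve 7 (λ e c σ e′ c′ σ′ x →
      e ⊕ (c ⊕ (σ ⊕ (e′ ⊕ (c′ ⊕ (σ′ ⊕ x))))) ⊜ (e ⊕ e′) ⊕ ((c ⊕ c′) ⊕ ((σ ⊕ σ′) ⊕ x))) refl

  swapCol-suc-self : ∀ {k} (j : Fin k) → swapCol F (suc j) (suc j) ≡ zero
  swapCol-suc-self j with j Fin.≟ j
  ... | yes _   = ≡.refl
  ... | no j≢j = contradiction ≡.refl j≢j

  swapCol-suc-other : ∀ {k} {j s : Fin k} → s ≢ j → swapCol F (suc j) (suc s) ≡ suc s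
  swapCol-suc-other {j = j} {s} s≢j with s Fin.≟ j
  ... | yes s≡j = contradiction s≡j s≢j
  ... | no _    = ≡.refl

  swapCol-involutive : ∀ {k} (j s : Fin k) → swapCol F j (swapCol F j s) ≡ s
  swapCol-involutive zero    zero    = ≡.refl
  swapCol-involutive zero    (suc s) = ≡.refl
  swapCol-involutive (suc j) zero    = swapCol-suc-self j
  swapCol-involutive (suc j) (suc s) = by-cases (s Fin.≟ j)
    where
    by-cases : Dec (s ≡ j) → swapCol F (suc j) (swapCol F (suc j) (suc s)) ≡ suc s
    by-cases (yes ≡.refl) = ≡.cong (swapCol F (suc j)) (swapCol-suc-self j)
    by-cases (no s≢j)     = ≡.trans (≡.cong (swapCol F (suc j)) (swapCol-suc-other s≢j)) (swapCol-suc-other s≢j)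

  colSign*colSign≈1 : ∀ {k} (j s : Fin k) → colSign F j s * colSign F j s ≈ 1#
  colSign*colSign≈1 zero    zero    = *-identityˡ 1#
  colSign*colSign≈1 zero    (suc s) = *-identityˡ 1#
  colSign*colSign≈1 (suc j) zero    = -1*-1≈1
  colSign*colSign≈1 (suc j) (suc s) = *-identityˡ 1#

  module _ {m : ℕ} (i : Fin (suc m)) where
    private
      n = suc m
      I = toℕ i

    cycRow-inRange : ∀ r → I ℕ.+ toℕ r ℕ.< n →
                     toℕ (proj₁ (cycRow F i r)) ≡ I ℕ.+ toℕ r × proj₂ (cycRow F i r) ≡ 1#
    cycRow-inRange r i+r<n with I ℕ.+ toℕ r ℕ.<? n
    ... | yes p = Fin.toℕ-fromℕ< p , ≡.refl
    ... | no i+r≮n = contradiction i+r<n i+r≮n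

    cycRow-wrapped : ∀ r → ¬ (I ℕ.+ toℕ r ℕ.< n) →
                     toℕ (proj₁ (cycRow F i r)) ℕ.+ n ≡ I ℕ.+ toℕ r × proj₂ (cycRow F i r) ≡ - 1#
    cycRow-wrapped r i+r≮n with I ℕ.+ toℕ r ℕ.<? n
    ... | yes i+r<n = contradiction i+r<n i+r≮n
    ... | no p = ≡.trans (≡.cong (ℕ._+ n) (Fin.toℕ-fromℕ< _)) (ℕ.m∸n+n≡m (ℕ.≮⇒≥ p)) , ≡.refl

    private
      q∸i<n : ∀ (q : Fin n) → toℕ q ℕ.∸ I ℕ.< n
      q∸i<n q = ℕ.≤-<-trans (ℕ.m∸n≤m (toℕ q) I) (Fin.toℕ<n q)

      q+n∸i<n : ∀ (q : Fin n) → ¬ (I ℕ.≤ toℕ q) → (toℕ q ℕ.+ n) ℕ.∸ I ℕ.< n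
      q+n∸i<n q i≰q = ≡.subst (ℕ._< n) (≡.sym (ℕ.+-∸-assoc (toℕ q) i≤n))
        (≡.subst (toℕ q ℕ.+ (n ℕ.∸ I) ℕ.<_) (ℕ.m+[n∸m]≡n i≤n) (ℕ.+-monoˡ-< (n ℕ.∸ I) (ℕ.≰⇒> i≰q)))
        where
        i≤n : I ℕ.≤ n
        i≤n = ℕ.<⇒≤ (Fin.toℕ<n i)

    uncycRow : Fin n → Fin n × Carrier
    uncycRow q with I ℕ.≤? toℕ q
    ... | yes _   = Fin.fromℕ< (q∸i<n q) , 1#
    ... | no  i≰q = Fin.fromℕ< (q+n∸i<n q i≰q) , - 1#

    uncycRow-inRange : ∀ q → I ℕ.≤ toℕ q →
                       toℕ (proj₁ (uncycRow q)) ≡ toℕ q ℕ.∸ I × proj₂ (uncycRow q) ≡ 1#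
    uncycRow-inRange q i≤q with I ℕ.≤? toℕ q
    ... | yes _   = Fin.toℕ-fromℕ< (q∸i<n q) , ≡.refl
    ... | no  i≰q = contradiction i≤q i≰q

    uncycRow-wrapped : ∀ q → ¬ (I ℕ.≤ toℕ q) →
                       toℕ (proj₁ (uncycRow q)) ≡ (toℕ q ℕ.+ n) ℕ.∸ I × proj₂ (uncycRow q) ≡ - 1#
    uncycRow-wrapped q i≰q with I ℕ.≤? toℕ q
    ... | yes i≤q = contradiction i≤q i≰q
    ... | no  p   = Fin.toℕ-fromℕ< (q+n∸i<n q p) , ≡.refl

    cycRow-uncycRow : ∀ q → let r = proj₁ (uncycRow q) in
                      proj₁ (cycRow F i r) ≡ q × proj₂ (uncycRow q) * proj₂ (cycRow F i r) ≈ 1#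
    cycRow-uncycRow q = by-cases (I ℕ.≤? toℕ q)
      where
      r = proj₁ (uncycRow q)
      by-cases : Dec (I ℕ.≤ toℕ q) → proj₁ (cycRow F i r) ≡ q × proj₂ (uncycRow q) * proj₂ (cycRow F i r) ≈ 1#
      by-cases (yes i≤q) = Fin.toℕ-injective (≡.trans (proj₁ back) i+r≡q) ,
                           trans (*-cong (reflexive (proj₂ there)) (reflexive (proj₂ back))) (*-identityˡ 1#)
        where
        there = uncycRow-inRange q i≤q
        i+r≡q : I ℕ.+ toℕ r ≡ toℕ q
        i+r≡q = ≡.trans (≡.cong (I ℕ.+_) (proj₁ there)) (ℕ.m+[n∸m]≡n i≤q)
        back = cycRow-inRange r (≡.subst (ℕ._< n) (≡.sym i+r≡q) (Fin.toℕ<n q))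
      by-cases (no i≰q) = Fin.toℕ-injective (ℕ.+-cancelʳ-≡ n _ _ (≡.trans (proj₁ back) i+r≡q+n)) ,
                          trans (*-cong (reflexive (proj₂ there)) (reflexive (proj₂ back))) -1*-1≈1
        where
        there = uncycRow-wrapped q i≰q
        i+r≡q+n : I ℕ.+ toℕ r ≡ toℕ q ℕ.+ n
        i+r≡q+n = ≡.trans (≡.cong (I ℕ.+_) (proj₁ there))
                          (ℕ.m+[n∸m]≡n (ℕ.≤-trans (ℕ.<⇒≤ (Fin.toℕ<n i)) (ℕ.m≤n+m n (toℕ q))))
        back = cycRow-wrapped r λ i+r<n →
          ℕ.<-irrefl ≡.refl (ℕ.<-≤-trans (≡.subst (ℕ._< n) i+r≡q+n i+r<n) (ℕ.m≤n+m n (toℕ q)))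

    uncycRow-cycRow : ∀ r → let q = proj₁ (cycRow F i r) in
                      proj₁ (uncycRow q) ≡ r × proj₂ (cycRow F i r) * proj₂ (uncycRow q) ≈ 1#
    uncycRow-cycRow r = by-cases (I ℕ.+ toℕ r ℕ.<? n)
      where
      q = proj₁ (cycRow F i r)
      by-cases : Dec (I ℕ.+ toℕ r ℕ.< n) →
                 proj₁ (uncycRow q) ≡ r × proj₂ (cycRow F i r) * proj₂ (uncycRow q) ≈ 1#
      i+r∸i≡r : ∀ {a} → a ≡ I ℕ.+ toℕ r → a ℕ.∸ I ≡ toℕ r
      i+r∸i≡r ≡.refl = ℕ.m+n∸m≡n I (toℕ r)
      by-cases (yes i+r<n) = Fin.toℕ-injective (≡.trans (proj₁ back) (i+r∸i≡r (proj₁ there))) ,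
                             trans (*-cong (reflexive (proj₂ there)) (reflexive (proj₂ back))) (*-identityˡ 1#)
        where
        there = cycRow-inRange r i+r<n
        back = uncycRow-inRange q (≡.subst (I ℕ.≤_) (≡.sym (proj₁ there)) (ℕ.m≤m+n I (toℕ r)))
      by-cases (no i+r≮n) = Fin.toℕ-injective (≡.trans (proj₁ back) (i+r∸i≡r (proj₁ there))) ,
                            trans (*-cong (reflexive (proj₂ there)) (reflexive (proj₂ back))) -1*-1≈1
        where
        there = cycRow-wrapped r i+r≮n
        back = uncycRow-wrapped q λ i≤q →
          ℕ.<-irrefl ≡.refl (ℕ.<-≤-trans (ℕ.+-monoʳ-< I (Fin.toℕ<n r))
                               (≡.subst (I ℕ.+ n ℕ.≤_) (proj₁ there) (ℕ.+-monoˡ-≤ n i≤q)))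

  S-isLinear : ∀ {n k} (i : Fin n) (j : Fin k) → IsLinear F (S F i j)
  S-isLinear {n} i j = monomialMap-isLinear (sgn F (n ℕ.∸ suc (toℕ i))) (colSign F j)
    (λ r → proj₂ (cycRow F i r)) (λ r → proj₁ (cycRow F i r)) (swapCol F j)

  S-isInvertible : ∀ {m k} (i : Fin (suc m)) (j : Fin k) → IsInvertible F (S F i j)
  S-isInvertible {m} i j =
    monomialMap e c⁻¹ σ⁻¹ ρ⁻¹ (swapCol F j) ,
    monomialMap-isLinear e c⁻¹ σ⁻¹ ρ⁻¹ (swapCol F j) ,
    monomialMap-inverseˡ e c⁻¹ σ⁻¹ ρ⁻¹ (swapCol F j) e (colSign F j) σ ρ (swapCol F j)
      (sgn*sgn≈1 (m ℕ.∸ toℕ i)) (λ t → colSign*colSign≈1 j (swapCol F j t))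
      (λ q → proj₂ (cycRow-uncycRow i q)) (λ q → proj₁ (cycRow-uncycRow i q)) (swapCol-involutive j) ,
    monomialMap-inverseˡ e (colSign F j) σ ρ (swapCol F j) e c⁻¹ σ⁻¹ ρ⁻¹ (swapCol F j)
      (sgn*sgn≈1 (m ℕ.∸ toℕ i))
      (λ s → trans (*-congˡ (reflexive (≡.cong (colSign F j) (swapCol-involutive j s)))) (colSign*colSign≈1 j s))
      (λ r → proj₂ (uncycRow-cycRow i r)) (λ r → proj₁ (uncycRow-cycRow i r)) (swapCol-involutive j)
    where
    e = sgn F (m ℕ.∸ toℕ i)
    σ = λ r → proj₂ (cycRow F i r)
    ρ = λ r → proj₁ (cycRow F i r)
    c⁻¹ = λ t → colSign F j (swapCol F j t)
    σ⁻¹ = λ q → proj₂ (uncycRow i q)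
    ρ⁻¹ = λ q → proj₁ (uncycRow i q)

open import Data.Nat using (_≤_; _+_)

lemma12 : ∀ {c ℓ : Level} (F : Field c ℓ) (n k : ℕ) → k ≤ n → 2 ∣ (n + k) →
              (i : Fin n) (j : Fin k) →
              IsLinear F (S F i j) × IsInvertible F (S F i j) ×
              (∀ (X : Mat F n k) → Field._≈_ F (cullis F (S F i j X)) (cullis F X))
lemma12 F zero    k _ 2∣n+k () j
lemma12 F (suc m) k _ 2∣n+k i j = S-isLinear F i j , S-isInvertible F i j , cullis-S F 2∣n+k i j
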